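{- Let $F_1,F_2,F_3,F_4$ be finite integral domains (i.e. finite fields) with $|F_i^*|=n_i$ for $i=1,2,3,4$ and $n_1\geq n_2\geq n_3\geq n_4$, and let $R=F_1\times F_2\times F_3\times F_4$. (i) If $n_1\geq n_2n_3n_4$, then $\alpha(\Gamma(R))=n_1(n_2n_3+n_2n_4+n_3n_4+n_2+n_3+n_4+1)$. (ii) If $n_1\leq n_2n_3n_4$ and $n_1n_4\geq n_2n_3$, then $\alpha(\Gamma(R))=n_1(n_2n_3+n_2n_4+n_3n_4+n_2+n_3+n_4)+n_2n_3n_4$. (iii) If $n_1n_4\leq n_2n_3$, then $\alpha(\Gamma(R))=n_1(n_2n_3+n_2n_4+n_3n_4+n_2+n_3)+n_2n_3+n_2n_3n_4$.
   Context: $F^*=F\setminus\{0\}$. For a commutative ring $R$ with $1\neq 0$, $\Gamma(R)$ is the simple undirected graph whose vertices are the nonzero zero-divisors of $R$, two distinct vertices $x,y$ being adjacent iff $xy=0$. $\alpha(G)$ is the independence number of a graph $G$ (maximum size of a set of pairwise non-adjacent vertices). -}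

module Defs where

open import Level using (Level; _⊔_)
open import Data.Nat using (ℕ; _≤_)
open import Data.Fin using (Fin)
open import Data.Product using (Σ; _×_; ∃; _,_)
open import Data.Sum using (_⊎_)
open import Data.List using (List; length; lookup)
open import Data.List.Relation.Unary.All using (All)
open import Data.List.Relation.Unary.Any using (Any)
open import Relation.Nullary using (¬_)
open import Relation.Binary.Definitions using (Decidable)
open import Relation.Binary.PropositionalEquality using (_≡_)
open import Algebra.Bundles using (CommutativeRing)
import Algebra.Construct.DirectProduct as DP

private variable c ℓ : Level

module _ (R : CommutativeRing c ℓ) where
  open CommutativeRing R

  IsVertex : Carrier → Set (c ⊔ ℓ)
  IsVertex x = ¬ (x ≈ 0#) × Σ Carrier (λ y → ¬ (y ≈ 0#) × (x * y ≈ 0#))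

  Adjacent : Carrier → Carrier → Set ℓ
  Adjacent x y = ¬ (x ≈ y) × (x * y ≈ 0#)

  IsIndependentSet : List Carrier → Set (c ⊔ ℓ)
  IsIndependentSet xs =
    All IsVertex xs ×
    (∀ (i j : Fin (length xs)) → ¬ (i ≡ j) →
       ¬ (lookup xs i ≈ lookup xs j) × ¬ Adjacent (lookup xs i) (lookup xs j))

  IndependenceNumberIs : ℕ → Set (c ⊔ ℓ)
  IndependenceNumberIs k =
    Σ (List Carrier) (λ xs → IsIndependentSet xs × length xs ≡ k) ×
    (∀ xs → IsIndependentSet xs → length xs ≤ k)

  IsIntegralDomain : Set (c ⊔ ℓ)
  IsIntegralDomain =
    ¬ (1# ≈ 0#) × Decidable _≈_ ×
    (∀ x y → x * y ≈ 0# → x ≈ 0# ⊎ y ≈ 0#)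

  -- R is finite with exactly n nonzero elements, i.e. |R^*| = n:
  -- a duplicate-free list of n nonzero elements containing every nonzero element
  NonzeroCount : ℕ → Set (c ⊔ ℓ)
  NonzeroCount n =
    Σ (List Carrier) λ xs →
      length xs ≡ n ×
      All (λ x → ¬ (x ≈ 0#)) xs ×
      (∀ (i j : Fin (length xs)) → lookup xs i ≈ lookup xs j → i ≡ j) ×
      (∀ x → ¬ (x ≈ 0#) → Any (λ y → x ≈ y) xs)

product4 : CommutativeRing c ℓ → CommutativeRing c ℓ → CommutativeRing c ℓ →
           CommutativeRing c ℓ → CommutativeRing c ℓ
product4 F₁ F₂ F₃ F₄ =
  DP.commutativeRing F₁ (DP.commutativeRing F₂ (DP.commutativeRing F₃ F₄))

-- An element of R = F₁ × F₂ × F₃ × F₄ is determined by its support S ⊆ {1,2,3,4} and its nonzero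
-- coordinates, so exactly w(S) = ∏_{i ∈ S} nᵢ elements have support S. Such an element is a vertex of Γ(R)
-- iff S is proper, and two elements have product zero iff their supports are disjoint. Hence the supports
-- of an independent set pairwise intersect; in particular it avoids one side of each of the seven
-- complementary pairs {S, Sᶜ} of proper supports, so α(Γ(R)) ≤ Σ max(w(S), w(Sᶜ)). Conversely, all
-- elements whose supports lie in a pairwise intersecting family form an independent set. In each of the
-- three cases the heavier sides of the seven pairs form such a family, and its total weight is the formula.
module Submission where

open import Level using (Level)
open import Function using (_∘_; id)
open import Function.Bundles using (_⇔_; mk⇔; Equivalence)
import Function.Properties.Equivalence as ⇔
open import Data.Bool using (Bool; true; false; not; _∧_; if_then_else_)
import Data.Bool.Properties as Bool
open import Data.Empty using (⊥-elim)
open import Data.Nat using (ℕ; _+_; _*_; _≤_; _≥_; _⊔_; z≤n; s≤s)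
open import Data.Nat.Properties
  using (≤-refl; ≤-trans; +-mono-≤; *-mono-≤; *-monoˡ-≤; *-monoʳ-≤; *-identityˡ; *-identityʳ;
         m≤m⊔n; m≤n⊔m; ⊔-lub; module ≤-Reasoning)
open import Data.Nat.ListAction using (sum)
open import Data.Nat.Tactic.RingSolver using (solve)
open import Data.Product using (∃; _×_; _,_; proj₁; proj₂)
open import Data.Product.Function.NonDependent.Propositional using (_×-⇔_)
open import Data.Sum using (_⊎_; inj₁; inj₂)
open import Data.Maybe using (Maybe; just; nothing; is-just)
open import Data.Fin as Fin using (Fin; zero; suc; #_)
open import Data.Fin.Properties using (injective⇒≤; any?; toℕ<n)
open import Data.Fin.Subset using (Subset; ∁; _∩_; _∪_; ⁅_⁆) renaming (⊥ to ∅; ⊤ to full)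
open import Data.Fin.Subset.Properties using (∩-inverseʳ; ∩-idem; ∩-identityˡ; anySubset?)
open import Data.Vec using ([]; _∷_)
import Data.Vec as Vec
import Data.Vec.Properties as Vecₚ
import Data.List as List
open import Data.List using (List; []; _∷_; length; lookup; map; _++_; concatMap; cartesianProduct; allFin)
open import Data.List.Properties using (length-map; length-++; length-tabulate; map-∘)
open import Data.List.Relation.Unary.All as All using (All; []; _∷_)
import Data.List.Relation.Unary.All.Properties as All
open import Data.List.Relation.Unary.AllPairs as AllPairs using (AllPairs; []; _∷_)
import Data.List.Relation.Unary.AllPairs.Properties as AllPairs
open import Data.List.Relation.Unary.Any as Any using (Any; here; there)
open import Data.List.Relation.Unary.Any.Properties using (lookup-index)
open import Data.List.Relation.Unary.Unique.Propositional using (Unique)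
import Data.List.Relation.Unary.Unique.Propositional.Properties as Unique
open import Data.List.Relation.Binary.Disjoint.Propositional using (Disjoint)
open import Data.List.Relation.Binary.Pointwise using (Pointwise; []; _∷_)
import Data.List.Relation.Binary.Pointwise.Properties as Pointwise
open import Data.List.Membership.Propositional using (_∈_)
open import Data.List.Membership.Propositional.Properties
  using (∈-lookup; ∈-map⁺; ∈-map⁻; ∈-allFin; ∈-cartesianProduct⁺; ∈-cartesianProduct⁻; ∈-concatMap⁺; ∈-concatMap⁻)
open import Relation.Nullary using (¬_; Dec; yes; no; does; ¬?)
open import Relation.Nullary.Decidable using (from-yes; from-no; decidable-stable; _×-dec_; _⊎-dec_; _→-dec_)
open import Relation.Binary using (Decidable; DecidableEquality)
open import Relation.Binary.PropositionalEquality
  using (_≡_; _≢_; refl; sym; trans; cong; cong₂; subst; module ≡-Reasoning)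
open import Algebra.Bundles using (CommutativeRing)
open import Defs

private variable
  a b r : Level
  A : Set a
  B : Set b

injective⇒≤-length : ∀ {m} {ys : List A} (f : Fin m → A) →
  (∀ {i j} → f i ≡ f j → i ≡ j) → (∀ i → f i ∈ ys) → m ≤ length ys
injective⇒≤-length {ys = ys} f f-injective f∈ys = injective⇒≤ position-injective
  where
  open ≡-Reasoning
  position-injective : ∀ {i j} → Any.index (f∈ys i) ≡ Any.index (f∈ys j) → i ≡ j
  position-injective {i} {j} eq = f-injective (begin
    f i                           ≡⟨ lookup-index (f∈ys i) ⟩
    lookup ys (Any.index (f∈ys i)) ≡⟨ cong (lookup ys) eq ⟩
    lookup ys (Any.index (f∈ys j)) ≡⟨ lookup-index (f∈ys j) ⟨
    f j                           ∎)

∈⇒AllPairs : {R : A → A → Set r} {xs : List A} →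
  (∀ {x y} → x ∈ xs → y ∈ xs → R x y) → AllPairs R xs
∈⇒AllPairs {xs = []}     R∈ = []
∈⇒AllPairs {xs = x ∷ xs} R∈ =
  All.tabulate (λ y∈xs → R∈ (here refl) (there y∈xs)) ∷ ∈⇒AllPairs (λ x∈ y∈ → R∈ (there x∈) (there y∈))

AllPairs-lookup : {R : A → A → Set r} → (∀ {x y} → R x y → R y x) →
  ∀ {xs} → AllPairs R xs → ∀ i j → i ≢ j → R (lookup xs i) (lookup xs j)
AllPairs-lookup R-sym (Rx ∷ Rxs) zero    zero    i≢j = ⊥-elim (i≢j refl)
AllPairs-lookup R-sym (Rx ∷ Rxs) zero    (suc j) i≢j = All.lookup Rx (∈-lookup j)
AllPairs-lookup R-sym (Rx ∷ Rxs) (suc i) zero    i≢j = R-sym (All.lookup Rx (∈-lookup i))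
AllPairs-lookup R-sym (Rx ∷ Rxs) (suc i) (suc j) i≢j = AllPairs-lookup R-sym Rxs i j (i≢j ∘ cong suc)

length-cartesianProduct : (xs : List A) (ys : List B) →
  length (cartesianProduct xs ys) ≡ length xs * length ys
length-cartesianProduct []       ys = refl
length-cartesianProduct (x ∷ xs) ys = begin
  length (map (x ,_) ys ++ cartesianProduct xs ys)          ≡⟨ length-++ (map (x ,_) ys) ⟩
  length (map (x ,_) ys) + length (cartesianProduct xs ys) ≡⟨ cong₂ _+_ (length-map (x ,_) ys) (length-cartesianProduct xs ys) ⟩
  length ys + length xs * length ys                        ∎
  where open ≡-Reasoning

sum-map-mono : {f : A → ℕ} {g : B → ℕ} {xs : List A} {ys : List B} →
  Pointwise (λ x y → f x ≤ g y) xs ys → sum (map f xs) ≤ sum (map g ys)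
sum-map-mono []             = z≤n
sum-map-mono (fx≤gy ∷ rest) = +-mono-≤ fx≤gy (sum-map-mono rest)

module _ {c ℓ} (R : CommutativeRing c ℓ) where
  open CommutativeRing R using (_≈_; *-cong) renaming (refl to ≈-refl; sym to ≈-sym; trans to ≈-trans)

  IsVertex-resp-≈ : ∀ {x y} → x ≈ y → IsVertex R x → IsVertex R y
  IsVertex-resp-≈ x≈y (x≉0 , z , z≉0 , xz≈0) =
    (λ y≈0 → x≉0 (≈-trans x≈y y≈0)) , z , z≉0 , ≈-trans (*-cong (≈-sym x≈y) ≈-refl) xz≈0

infix 4 _≟ₛ_
_≟ₛ_ : ∀ {n} → DecidableEquality (Subset n)
_≟ₛ_ = Vecₚ.≡-dec Bool._≟_

∁-involutive : ∀ {n} (p : Subset n) → ∁ (∁ p) ≡ p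
∁-involutive p = begin
  ∁ (∁ p)               ≡⟨ Vecₚ.map-∘ not not p ⟨
  Vec.map (not ∘ not) p ≡⟨ Vecₚ.map-cong Bool.not-involutive p ⟩
  Vec.map id p          ≡⟨ Vecₚ.map-id p ⟩
  p                     ∎
  where open ≡-Reasoning

Proper : ∀ {n} → Subset n → Set
Proper s = s ≢ ∅ × s ≢ full

proper? : ∀ {n} (s : Subset n) → Dec (Proper s)
proper? s = ¬? (s ≟ₛ ∅) ×-dec ¬? (s ≟ₛ full)

≡∅⇔pointwise : ∀ {b₁ b₂ b₃ b₄} →
  (b₁ ∷ b₂ ∷ b₃ ∷ b₄ ∷ []) ≡ ∅ ⇔ (b₁ ≡ false × b₂ ≡ false × b₃ ≡ false × b₄ ≡ false)
≡∅⇔pointwise = mk⇔ (λ { refl → refl , refl , refl , refl }) (λ { (refl , refl , refl , refl) → refl })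

Intersecting : ∀ {n} → List (Subset n) → Set
Intersecting ss = All (λ s → All (λ t → s ∩ t ≢ ∅) ss) ss

intersecting? : ∀ {n} (ss : List (Subset n)) → Dec (Intersecting ss)
intersecting? ss = All.all? (λ s → All.all? (λ t → ¬? (s ∩ t ≟ₛ ∅)) ss) ss

IntersectingFamily : ∀ {n} → List (Subset n) → Set
IntersectingFamily ss = Unique ss × All Proper ss × Intersecting ss

intersectingFamily? : ∀ {n} (ss : List (Subset n)) → Dec (IntersectingFamily ss)
intersectingFamily? ss = unique? ss ×-dec All.all? proper? ss ×-dec intersecting? ss
  where open import Data.List.Relation.Unary.Unique.DecPropositional _≟ₛ_ using (unique?)

-- side r is the side of the pair {r, ∁ r} on which P holds; if the subsets satisfying P pairwise
-- intersect, P never holds on both sides.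
module Sides {n p} {P : Subset n → Set p} (P? : ∀ s → Dec (P s)) where

  side : Subset n → Subset n
  side r = if does (P? (∁ r)) then ∁ r else r

  side-covers : ∀ {reps} → (∀ {s} → P s → s ∈ reps ⊎ ∁ s ∈ reps) →
    (∀ {s t} → P s → P t → s ∩ t ≢ ∅) → ∀ {s} → P s → s ∈ map side reps
  side-covers covers meet {s} Ps with covers Ps
  ... | inj₁ s∈reps = subst (_∈ map side _) side-s (∈-map⁺ side s∈reps)
    where
    side-s : side s ≡ s
    side-s with P? (∁ s)
    ... | yes P∁s = ⊥-elim (meet Ps P∁s (∩-inverseʳ s))
    ... | no _    = refl
  ... | inj₂ ∁s∈reps = subst (_∈ map side _) side-∁s (∈-map⁺ side ∁s∈reps)
    where
    side-∁s : side (∁ s) ≡ s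
    side-∁s with P? (∁ (∁ s))
    ... | yes _  = ∁-involutive s
    ... | no ¬P  = ⊥-elim (¬P (subst P (sym (∁-involutive s)) Ps))

  side-≤ : (w : Subset n → ℕ) → ∀ r → w (side r) ≤ w r ⊔ w (∁ r)
  side-≤ w r with P? (∁ r)
  ... | yes _ = m≤n⊔m (w r) (w (∁ r))
  ... | no _  = m≤m⊔n (w r) (w (∁ r))

-- Index i stands for the factor F_(i+1). The seven complementary pairs of proper subsets are represented
-- by their members containing 0. When n₁ ≥ n₂ ≥ n₃ ≥ n₄, five representatives are always the heavier
-- side of their pair, so only the first and the last pair depend on the case.
selection : Subset 4 → Subset 4 → List (Subset 4)
selection s₁ s₇ =
  s₁ ∷ ∁ ⁅ # 1 ⁆ ∷ ∁ ⁅ # 2 ⁆ ∷ ∁ ⁅ # 3 ⁆ ∷ ⁅ # 0 ⁆ ∪ ⁅ # 1 ⁆ ∷ ⁅ # 0 ⁆ ∪ ⁅ # 2 ⁆ ∷ s₇ ∷ []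

pairs : List (Subset 4)
pairs = selection ⁅ # 0 ⁆ (⁅ # 0 ⁆ ∪ ⁅ # 3 ⁆)

selection-I selection-II selection-III : List (Subset 4)
selection-I   = pairs
selection-II  = selection (∁ ⁅ # 0 ⁆) (⁅ # 0 ⁆ ∪ ⁅ # 3 ⁆)
selection-III = selection (∁ ⁅ # 0 ⁆) (⁅ # 1 ⁆ ∪ ⁅ # 2 ⁆)

proper⇒∈pairs⊎∁∈pairs : ∀ s → Proper s → s ∈ pairs ⊎ ∁ s ∈ pairs
proper⇒∈pairs⊎∁∈pairs s = decidable-stable (claim? s) λ ¬claim → no-counterexample (s , ¬claim)
  where
  open import Data.List.Membership.DecPropositional _≟ₛ_ using (_∈?_)
  claim? : ∀ s → Dec (Proper s → s ∈ pairs ⊎ ∁ s ∈ pairs)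
  claim? s = proper? s →-dec (s ∈? pairs ⊎-dec ∁ s ∈? pairs)
  no-counterexample : ¬ ∃ λ s → ¬ (Proper s → s ∈ pairs ⊎ ∁ s ∈ pairs)
  no-counterexample = from-no (anySubset? (¬? ∘ claim?))

scale : Bool → ℕ → ℕ → ℕ
scale true  n k = n * k
scale false n k = k

module Weights (n₁ n₂ n₃ n₄ : ℕ) where

  -- Unfolds to a right-nested product ending in * 1; the bounds below are stated in that shape.
  weight : Subset 4 → ℕ
  weight (b₁ ∷ b₂ ∷ b₃ ∷ b₄ ∷ []) = scale b₁ n₁ (scale b₂ n₂ (scale b₃ n₃ (scale b₄ n₄ 1)))

  pairWeight : Subset 4 → ℕ
  pairWeight r = weight r ⊔ weight (∁ r)

  Heaviest : List (Subset 4) → Set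
  Heaviest ss = Pointwise (λ r s → pairWeight r ≤ weight s) pairs ss

-- Coordinates in a finite integral domain

module Coordinates {c ℓ} (F : CommutativeRing c ℓ) (domain : IsIntegralDomain F)
                   {n : ℕ} (count : NonzeroCount F n) where
  open CommutativeRing F using (Carrier; _≈_; 0#; 1#; zeroˡ; zeroʳ)
    renaming (_*_ to _·_; refl to ≈-refl; sym to ≈-sym)

  private
    _≈?_ : Decidable _≈_
    _≈?_ = proj₁ (proj₂ domain)

    elems : List Carrier
    elems = proj₁ count

    length-elems : length elems ≡ n
    length-elems = proj₁ (proj₂ count)

    lookup-injective : ∀ i j → lookup elems i ≈ lookup elems j → i ≡ j
    lookup-injective = proj₁ (proj₂ (proj₂ (proj₂ count)))

    covers : ∀ x → ¬ (x ≈ 0#) → Any (x ≈_) elems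
    covers = proj₂ (proj₂ (proj₂ (proj₂ count)))

    lookup≉0 : ∀ i → ¬ (lookup elems i ≈ 0#)
    lookup≉0 i = All.lookup (proj₁ (proj₂ (proj₂ count))) (∈-lookup i)

  Coord : Set
  Coord = Maybe (Fin (length elems))

  value : Coord → Carrier
  value nothing  = 0#
  value (just i) = lookup elems i

  coord : Carrier → Coord
  coord x with x ≈? 0#
  ... | yes _   = nothing
  ... | no x≉0  = just (Any.index (covers x x≉0))

  value-coord : ∀ x → x ≈ value (coord x)
  value-coord x with x ≈? 0#
  ... | yes x≈0 = x≈0
  ... | no x≉0  = lookup-index (covers x x≉0)

  value-injective : ∀ a b → value a ≈ value b → a ≡ b
  value-injective nothing  nothing  _   = refl
  value-injective nothing  (just j) 0≈y = ⊥-elim (lookup≉0 j (≈-sym 0≈y))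
  value-injective (just i) nothing  x≈0 = ⊥-elim (lookup≉0 i x≈0)
  value-injective (just i) (just j) x≈y = cong just (lookup-injective i j x≈y)

  value≈0⇔ : ∀ a → value a ≈ 0# ⇔ is-just a ≡ false
  value≈0⇔ nothing  = mk⇔ (λ _ → refl) (λ _ → ≈-refl)
  value≈0⇔ (just i) = mk⇔ (⊥-elim ∘ lookup≉0 i) λ ()

  value·value≈0⇔ : ∀ a b → value a · value b ≈ 0# ⇔ (is-just a ∧ is-just b) ≡ false
  value·value≈0⇔ nothing  b        = mk⇔ (λ _ → refl) (λ _ → zeroˡ (value b))
  value·value≈0⇔ (just i) nothing  = mk⇔ (λ _ → refl) (λ _ → zeroʳ (lookup elems i))
  value·value≈0⇔ (just i) (just j) = mk⇔ no-zero-divisors λ ()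
    where
    no-zero-divisors : lookup elems i · lookup elems j ≈ 0# → true ≡ false
    no-zero-divisors xy≈0 with proj₂ (proj₂ domain) _ _ xy≈0
    ... | inj₁ x≈0 = ⊥-elim (lookup≉0 i x≈0)
    ... | inj₂ y≈0 = ⊥-elim (lookup≉0 j y≈0)

  one : Fin (length elems)
  one = Any.index (covers 1# (proj₁ domain))

  1≤n : 1 ≤ n
  1≤n = subst (1 ≤_) length-elems (≤-trans (s≤s z≤n) (toℕ<n one))

  complement : Coord → Coord
  complement nothing  = just one
  complement (just _) = nothing

  is-just-complement : ∀ a → is-just (complement a) ≡ not (is-just a)
  is-just-complement nothing  = refl
  is-just-complement (just _) = refl

  coordsWith : Bool → List Coord
  coordsWith true  = map just (allFin (length elems))
  coordsWith false = nothing ∷ []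

  ∈-coordsWith : ∀ a → a ∈ coordsWith (is-just a)
  ∈-coordsWith nothing  = here refl
  ∈-coordsWith (just i) = ∈-map⁺ just (∈-allFin i)

  ∈-coordsWith⁻ : ∀ {a} b → a ∈ coordsWith b → is-just a ≡ b
  ∈-coordsWith⁻ true  a∈ with ∈-map⁻ just a∈
  ... | _ , _ , refl = refl
  ∈-coordsWith⁻ false (here refl) = refl

  coordsWith-unique : ∀ b → Unique (coordsWith b)
  coordsWith-unique true  = Unique.map⁺ just-injective (Unique.allFin⁺ (length elems))
    where
    just-injective : ∀ {i j : Fin (length elems)} → just i ≡ just j → i ≡ j
    just-injective refl = refl
  coordsWith-unique false = [] ∷ []

  length-coordsWith : ∀ b k → length (coordsWith b) * k ≡ scale b n k
  length-coordsWith true  k = cong (_* k) (trans (length-map just (allFin (length elems)))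
                                                  (trans (length-tabulate {n = length elems} id) length-elems))
  length-coordsWith false k = *-identityˡ k

  length-cartesianProduct-coordsWith : ∀ b (ys : List B) →
    length (cartesianProduct (coordsWith b) ys) ≡ scale b n (length ys)
  length-cartesianProduct-coordsWith b ys =
    trans (length-cartesianProduct (coordsWith b) ys) (length-coordsWith b (length ys))

-- The product of four finite integral domains

module Product4 {c ℓ} (F₁ F₂ F₃ F₄ : CommutativeRing c ℓ)
  (D₁ : IsIntegralDomain F₁) (D₂ : IsIntegralDomain F₂) (D₃ : IsIntegralDomain F₃) (D₄ : IsIntegralDomain F₄)
  {n₁ n₂ n₃ n₄ : ℕ}
  (N₁ : NonzeroCount F₁ n₁) (N₂ : NonzeroCount F₂ n₂) (N₃ : NonzeroCount F₃ n₃) (N₄ : NonzeroCount F₄ n₄)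
  where

  private
    module C₁ = Coordinates F₁ D₁ N₁
    module C₂ = Coordinates F₂ D₂ N₂
    module C₃ = Coordinates F₃ D₃ N₃
    module C₄ = Coordinates F₄ D₄ N₄
    R₄ : CommutativeRing c ℓ
    R₄ = product4 F₁ F₂ F₃ F₄
    module R = CommutativeRing R₄

  open Weights n₁ n₂ n₃ n₄
  open Equivalence using (to; from)

  Code : Set
  Code = C₁.Coord × C₂.Coord × C₃.Coord × C₄.Coord

  support : Code → Subset 4
  support (a₁ , a₂ , a₃ , a₄) = is-just a₁ ∷ is-just a₂ ∷ is-just a₃ ∷ is-just a₄ ∷ []

  decode : Code → R.Carrier
  decode (a₁ , a₂ , a₃ , a₄) = C₁.value a₁ , C₂.value a₂ , C₃.value a₃ , C₄.value a₄

  encode : R.Carrier → Code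
  encode (x₁ , x₂ , x₃ , x₄) = C₁.coord x₁ , C₂.coord x₂ , C₃.coord x₃ , C₄.coord x₄

  decode-encode : ∀ x → x R.≈ decode (encode x)
  decode-encode (x₁ , x₂ , x₃ , x₄) =
    C₁.value-coord x₁ , C₂.value-coord x₂ , C₃.value-coord x₃ , C₄.value-coord x₄

  decode-injective : ∀ c d → decode c R.≈ decode d → c ≡ d
  decode-injective (a₁ , a₂ , a₃ , a₄) (b₁ , b₂ , b₃ , b₄) (e₁ , e₂ , e₃ , e₄) =
    cong₂ _,_ (C₁.value-injective a₁ b₁ e₁) (cong₂ _,_ (C₂.value-injective a₂ b₂ e₂)
      (cong₂ _,_ (C₃.value-injective a₃ b₃ e₃) (C₄.value-injective a₄ b₄ e₄)))

  decode≈0⇔ : ∀ c → decode c R.≈ R.0# ⇔ support c ≡ ∅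
  decode≈0⇔ (a₁ , a₂ , a₃ , a₄) = ⇔.trans
    (C₁.value≈0⇔ a₁ ×-⇔ C₂.value≈0⇔ a₂ ×-⇔ C₃.value≈0⇔ a₃ ×-⇔ C₄.value≈0⇔ a₄) (⇔.sym ≡∅⇔pointwise)

  decode*decode≈0⇔ : ∀ c d → decode c R.* decode d R.≈ R.0# ⇔ support c ∩ support d ≡ ∅
  decode*decode≈0⇔ (a₁ , a₂ , a₃ , a₄) (b₁ , b₂ , b₃ , b₄) = ⇔.trans
    (C₁.value·value≈0⇔ a₁ b₁ ×-⇔ C₂.value·value≈0⇔ a₂ b₂ ×-⇔
     C₃.value·value≈0⇔ a₃ b₃ ×-⇔ C₄.value·value≈0⇔ a₄ b₄) (⇔.sym ≡∅⇔pointwise)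

  complement : Code → Code
  complement (a₁ , a₂ , a₃ , a₄) = C₁.complement a₁ , C₂.complement a₂ , C₃.complement a₃ , C₄.complement a₄

  support-complement : ∀ c → support (complement c) ≡ ∁ (support c)
  support-complement (a₁ , a₂ , a₃ , a₄) =
    cong₂ _∷_ (C₁.is-just-complement a₁) (cong₂ _∷_ (C₂.is-just-complement a₂)
      (cong₂ _∷_ (C₃.is-just-complement a₃) (cong (_∷ []) (C₄.is-just-complement a₄))))

  isVertex⇔proper : ∀ c → IsVertex R₄ (decode c) ⇔ Proper (support c)
  isVertex⇔proper c = mk⇔ vertex⇒proper proper⇒vertex
    where
    open ≡-Reasoning

    vertex⇒proper : IsVertex R₄ (decode c) → Proper (support c)
    vertex⇒proper (c≉0 , y , y≉0 , cy≈0) = c≉0 ∘ from (decode≈0⇔ c) , y≉0 ∘ annihilated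
      where
      annihilated : support c ≡ full → y R.≈ R.0#
      annihilated c-full = R.trans (decode-encode y) (from (decode≈0⇔ (encode y)) (begin
        support (encode y)               ≡⟨ ∩-identityˡ _ ⟨
        full ∩ support (encode y)        ≡⟨ cong (_∩ support (encode y)) c-full ⟨
        support c ∩ support (encode y)   ≡⟨ to (decode*decode≈0⇔ c (encode y))
                                               (R.trans (R.*-cong R.refl (R.sym (decode-encode y))) cy≈0) ⟩
        ∅                                ∎))

    proper⇒vertex : Proper (support c) → IsVertex R₄ (decode c)
    proper⇒vertex (c≢∅ , c≢full) =
      c≢∅ ∘ to (decode≈0⇔ c) , decode (complement c) , complement≉0 ,
      from (decode*decode≈0⇔ c (complement c))
        (trans (cong (support c ∩_) (support-complement c)) (∩-inverseʳ (support c)))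
      where
      complement≉0 : ¬ (decode (complement c) R.≈ R.0#)
      complement≉0 c̄≈0 = c≢full (begin
        support c           ≡⟨ ∁-involutive (support c) ⟨
        ∁ (∁ (support c))   ≡⟨ cong ∁ (support-complement c) ⟨
        ∁ (support (complement c)) ≡⟨ cong ∁ (to (decode≈0⇔ (complement c)) c̄≈0) ⟩
        full                ∎)

  members : Subset 4 → List Code
  members (b₁ ∷ b₂ ∷ b₃ ∷ b₄ ∷ []) =
    cartesianProduct (C₁.coordsWith b₁) (cartesianProduct (C₂.coordsWith b₂)
      (cartesianProduct (C₃.coordsWith b₃) (C₄.coordsWith b₄)))

  ∈-members : ∀ c → c ∈ members (support c)
  ∈-members (a₁ , a₂ , a₃ , a₄) =
    ∈-cartesianProduct⁺ (C₁.∈-coordsWith a₁) (∈-cartesianProduct⁺ (C₂.∈-coordsWith a₂)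
      (∈-cartesianProduct⁺ (C₃.∈-coordsWith a₃) (C₄.∈-coordsWith a₄)))

  ∈-members⁻ : ∀ s {c} → c ∈ members s → support c ≡ s
  ∈-members⁻ (b₁ ∷ b₂ ∷ b₃ ∷ b₄ ∷ []) c∈ =
    let a₁∈ , a₂₃₄∈ = ∈-cartesianProduct⁻ _ _ c∈
        a₂∈ , a₃₄∈  = ∈-cartesianProduct⁻ _ _ a₂₃₄∈
        a₃∈ , a₄∈   = ∈-cartesianProduct⁻ _ _ a₃₄∈
    in cong₂ _∷_ (C₁.∈-coordsWith⁻ b₁ a₁∈) (cong₂ _∷_ (C₂.∈-coordsWith⁻ b₂ a₂∈)
         (cong₂ _∷_ (C₃.∈-coordsWith⁻ b₃ a₃∈) (cong (_∷ []) (C₄.∈-coordsWith⁻ b₄ a₄∈))))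

  members-unique : ∀ s → Unique (members s)
  members-unique (b₁ ∷ b₂ ∷ b₃ ∷ b₄ ∷ []) =
    Unique.cartesianProduct⁺ (C₁.coordsWith-unique b₁) (Unique.cartesianProduct⁺ (C₂.coordsWith-unique b₂)
      (Unique.cartesianProduct⁺ (C₃.coordsWith-unique b₃) (C₄.coordsWith-unique b₄)))

  length-members : ∀ s → length (members s) ≡ weight s
  length-members (b₁ ∷ b₂ ∷ b₃ ∷ b₄ ∷ []) =
    trans (C₁.length-cartesianProduct-coordsWith b₁ _) (cong (scale b₁ n₁)
      (trans (C₂.length-cartesianProduct-coordsWith b₂ _) (cong (scale b₂ n₂)
        (trans (C₃.length-cartesianProduct-coordsWith b₃ _) (cong (scale b₃ n₃)
          (trans (sym (*-identityʳ _)) (C₄.length-coordsWith b₄ 1)))))))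

  family : List (Subset 4) → List Code
  family = concatMap members

  ∈-family⁺ : ∀ {ss c} → support c ∈ ss → c ∈ family ss
  ∈-family⁺ {c = c} c∈ss = ∈-concatMap⁺ members (Any.map (λ { refl → ∈-members c }) c∈ss)

  ∈-family⁻ : ∀ {ss c} → c ∈ family ss → support c ∈ ss
  ∈-family⁻ c∈ = Any.map (λ {s} → ∈-members⁻ s) (∈-concatMap⁻ members c∈)

  family-unique : ∀ {ss} → Unique ss → Unique (family ss)
  family-unique ss-unique =
    Unique.concat⁺ (All.map⁺ (All.universal members-unique _)) (AllPairs.map⁺ (AllPairs.map disjoint ss-unique))
    where
    disjoint : ∀ {s t} → s ≢ t → Disjoint (members s) (members t)
    disjoint {s} {t} s≢t (c∈s , c∈t) = s≢t (trans (sym (∈-members⁻ s c∈s)) (∈-members⁻ t c∈t))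

  length-family : ∀ ss → length (family ss) ≡ sum (map weight ss)
  length-family []       = refl
  length-family (s ∷ ss) = trans (length-++ (members s)) (cong₂ _+_ (length-members s) (length-family ss))

  Separated : R.Carrier → R.Carrier → Set ℓ
  Separated x y = ¬ (x R.≈ y) × ¬ (x R.* y R.≈ R.0#)

  Separated-sym : ∀ {x y} → Separated x y → Separated y x
  Separated-sym (x≉y , xy≉0) = x≉y ∘ R.sym , xy≉0 ∘ R.trans (R.*-comm _ _)

  decode-isIndependentSet : ∀ {cs} → Unique cs → All (Proper ∘ support) cs →
    (∀ {c d} → c ∈ cs → d ∈ cs → support c ∩ support d ≢ ∅) →
    IsIndependentSet R₄ (map decode cs)
  decode-isIndependentSet {cs} cs-unique proper meet = vertices , separated
    where
    vertices : All (IsVertex R₄) (map decode cs)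
    vertices = All.map⁺ (All.map (λ {c} → from (isVertex⇔proper c)) proper)

    separated-codes : AllPairs (λ c d → Separated (decode c) (decode d)) cs
    separated-codes = AllPairs.zipWith
      (λ { {c} {d} (c≢d , c∩d≢∅) → c≢d ∘ decode-injective c d , c∩d≢∅ ∘ to (decode*decode≈0⇔ c d) })
      (cs-unique , ∈⇒AllPairs meet)

    separated : ∀ i j → i ≢ j →
      ¬ (lookup (map decode cs) i R.≈ lookup (map decode cs) j) × ¬ Adjacent R₄ (lookup (map decode cs) i) (lookup (map decode cs) j)
    separated i j i≢j =
      let x≉y , xy≉0 = AllPairs-lookup {R = Separated} Separated-sym (AllPairs.map⁺ separated-codes) i j i≢j
      in x≉y , xy≉0 ∘ proj₂

  independentSet-length≤ : ∀ {xs} → IsIndependentSet R₄ xs → length xs ≤ sum (map pairWeight pairs)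
  independentSet-length≤ {xs} (vertices , separated) = begin
    length xs                          ≤⟨ injective⇒≤-length code code-injective (∈-family⁺ ∘ covered) ⟩
    length (family (map side pairs))   ≡⟨ length-family (map side pairs) ⟩
    sum (map weight (map side pairs))  ≡⟨ cong sum (map-∘ {g = weight} {f = side} pairs) ⟨
    sum (map (weight ∘ side) pairs)    ≤⟨ sum-map-mono {f = weight ∘ side} {xs = pairs} (Pointwise.refl (λ {r} → side-≤ weight r)) ⟩
    sum (map pairWeight pairs)         ∎
    where
    open ≤-Reasoning

    code : Fin (length xs) → Code
    code i = encode (lookup xs i)

    open Sides (λ s → any? λ i → support (code i) ≟ₛ s)

    code-injective : ∀ {i j} → code i ≡ code j → i ≡ j
    code-injective {i} {j} eq with i Fin.≟ j
    ... | yes i≡j = i≡j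
    ... | no i≢j  = ⊥-elim (proj₁ (separated i j i≢j)
                      (R.trans (decode-encode _) (R.trans (R.reflexive (cong decode eq)) (R.sym (decode-encode _)))))

    proper : ∀ i → Proper (support (code i))
    proper i = to (isVertex⇔proper (code i))
      (IsVertex-resp-≈ R₄ (decode-encode _) (All.lookup vertices (∈-lookup i)))

    meet : ∀ i j → support (code i) ∩ support (code j) ≢ ∅
    meet i j with i Fin.≟ j
    ... | yes refl = proj₁ (proper i) ∘ trans (sym (∩-idem _))
    ... | no i≢j   = λ disjoint → proj₂ (separated i j i≢j) (proj₁ (separated i j i≢j) ,
                       R.trans (R.*-cong (decode-encode _) (decode-encode _)) (from (decode*decode≈0⇔ (code i) (code j)) disjoint))

    covered : ∀ i → support (code i) ∈ map side pairs
    covered i = side-covers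
      (λ { {s} (j , refl) → proper⇒∈pairs⊎∁∈pairs s (proper j) })
      (λ { (j , refl) (k , refl) → meet j k })
      (i , refl)

  independenceNumber : ∀ ss → IntersectingFamily ss → Heaviest ss → IndependenceNumberIs R₄ (sum (map weight ss))
  independenceNumber ss (ss-unique , ss-proper , ss-intersecting) heavier =
    (map decode (family ss) , independent , trans (length-map decode (family ss)) (length-family ss)) ,
    λ xs xs-independent → ≤-trans (independentSet-length≤ xs-independent) (sum-map-mono heavier)
    where
    independent : IsIndependentSet R₄ (map decode (family ss))
    independent = decode-isIndependentSet (family-unique ss-unique)
      (All.tabulate (All.lookup ss-proper ∘ ∈-family⁻))
      (λ c∈ d∈ → All.lookup (All.lookup ss-intersecting (∈-family⁻ c∈)) (∈-family⁻ d∈))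

-- The three extremal selections

module Selections {n₁ n₂ n₃ n₄ : ℕ} (n₂≤n₁ : n₂ ≤ n₁) (n₃≤n₂ : n₃ ≤ n₂) (n₄≤n₃ : n₄ ≤ n₃) (1≤n₄ : 1 ≤ n₄) where
  open Weights n₁ n₂ n₃ n₄

  private
    n₃≤n₁ : n₃ ≤ n₁
    n₃≤n₁ = ≤-trans n₃≤n₂ n₂≤n₁
    n₄≤n₂ : n₄ ≤ n₂
    n₄≤n₂ = ≤-trans n₄≤n₃ n₃≤n₂
    1≤n₃ : 1 ≤ n₃
    1≤n₃ = ≤-trans 1≤n₄ n₄≤n₃
    1≤n₂ : 1 ≤ n₂
    1≤n₂ = ≤-trans 1≤n₃ n₃≤n₂
    n₁≤n₁n₄ : n₁ * 1 ≤ n₁ * (n₄ * 1)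
    n₁≤n₁n₄ = *-monoʳ-≤ n₁ (*-monoˡ-≤ 1 1≤n₄)
    n₂n₃≤n₂n₃n₄ : n₂ * (n₃ * 1) ≤ n₂ * (n₃ * (n₄ * 1))
    n₂n₃≤n₂n₃n₄ = *-monoʳ-≤ n₂ (*-monoʳ-≤ n₃ (*-monoˡ-≤ 1 1≤n₄))

  selection-heaviest : ∀ {s₁ s₇} → pairWeight ⁅ # 0 ⁆ ≤ weight s₁ → pairWeight (⁅ # 0 ⁆ ∪ ⁅ # 3 ⁆) ≤ weight s₇ →
    Heaviest (selection s₁ s₇)
  selection-heaviest first last =
    first ∷
    ⊔-lub ≤-refl (*-mono-≤ n₂≤n₁ (*-mono-≤ 1≤n₃ (*-mono-≤ 1≤n₄ ≤-refl))) ∷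
    ⊔-lub ≤-refl (*-mono-≤ n₃≤n₁ (*-mono-≤ 1≤n₂ (*-mono-≤ 1≤n₄ ≤-refl))) ∷
    ⊔-lub ≤-refl (*-mono-≤ (≤-trans n₄≤n₂ n₂≤n₁) (*-mono-≤ 1≤n₂ (*-mono-≤ 1≤n₃ ≤-refl))) ∷
    ⊔-lub ≤-refl (*-mono-≤ n₃≤n₁ (*-mono-≤ n₄≤n₂ ≤-refl)) ∷
    ⊔-lub ≤-refl (*-mono-≤ n₂≤n₁ (*-mono-≤ n₄≤n₃ ≤-refl)) ∷
    last ∷ []

  heaviest-I : n₁ ≥ n₂ * n₃ * n₄ → Heaviest selection-I
  heaviest-I n₂n₃n₄≤n₁ = selection-heaviest (⊔-lub ≤-refl n₂n₃n₄≤n₁′) (⊔-lub ≤-refl (begin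
    n₂ * (n₃ * 1)        ≤⟨ n₂n₃≤n₂n₃n₄ ⟩
    n₂ * (n₃ * (n₄ * 1)) ≤⟨ n₂n₃n₄≤n₁′ ⟩
    n₁ * 1               ≤⟨ n₁≤n₁n₄ ⟩
    n₁ * (n₄ * 1)        ∎))
    where
    open ≤-Reasoning
    n₂n₃n₄≤n₁′ : n₂ * (n₃ * (n₄ * 1)) ≤ n₁ * 1
    n₂n₃n₄≤n₁′ = begin
      n₂ * (n₃ * (n₄ * 1)) ≡⟨ solve (n₂ List.∷ n₃ List.∷ n₄ List.∷ List.[]) ⟩
      n₂ * n₃ * n₄         ≤⟨ n₂n₃n₄≤n₁ ⟩
      n₁                   ≡⟨ solve (n₁ List.∷ List.[]) ⟩
      n₁ * 1               ∎

  heaviest-II : n₁ ≤ n₂ * n₃ * n₄ → n₁ * n₄ ≥ n₂ * n₃ → Heaviest selection-II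
  heaviest-II n₁≤n₂n₃n₄ n₂n₃≤n₁n₄ = selection-heaviest (⊔-lub (begin
    n₁ * 1               ≡⟨ solve (n₁ List.∷ List.[]) ⟩
    n₁                   ≤⟨ n₁≤n₂n₃n₄ ⟩
    n₂ * n₃ * n₄         ≡⟨ solve (n₂ List.∷ n₃ List.∷ n₄ List.∷ List.[]) ⟩
    n₂ * (n₃ * (n₄ * 1)) ∎) ≤-refl) (⊔-lub ≤-refl (begin
    n₂ * (n₃ * 1)        ≡⟨ solve (n₂ List.∷ n₃ List.∷ List.[]) ⟩
    n₂ * n₃              ≤⟨ n₂n₃≤n₁n₄ ⟩
    n₁ * n₄              ≡⟨ solve (n₁ List.∷ n₄ List.∷ List.[]) ⟩
    n₁ * (n₄ * 1)        ∎))
    where open ≤-Reasoning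

  heaviest-III : n₁ * n₄ ≤ n₂ * n₃ → Heaviest selection-III
  heaviest-III n₁n₄≤n₂n₃ = selection-heaviest (⊔-lub (begin
    n₁ * 1               ≤⟨ n₁≤n₁n₄ ⟩
    n₁ * (n₄ * 1)        ≤⟨ n₁n₄≤n₂n₃′ ⟩
    n₂ * (n₃ * 1)        ≤⟨ n₂n₃≤n₂n₃n₄ ⟩
    n₂ * (n₃ * (n₄ * 1)) ∎) ≤-refl) (⊔-lub n₁n₄≤n₂n₃′ ≤-refl)
    where
    open ≤-Reasoning
    n₁n₄≤n₂n₃′ : n₁ * (n₄ * 1) ≤ n₂ * (n₃ * 1)
    n₁n₄≤n₂n₃′ = begin
      n₁ * (n₄ * 1)        ≡⟨ solve (n₁ List.∷ n₄ List.∷ List.[]) ⟩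
      n₁ * n₄              ≤⟨ n₁n₄≤n₂n₃ ⟩
      n₂ * n₃              ≡⟨ solve (n₂ List.∷ n₃ List.∷ List.[]) ⟩
      n₂ * (n₃ * 1)        ∎

  sum-selection : ∀ s₁ s₇ →
    sum (map weight (selection s₁ s₇)) ≡ weight s₁ + weight s₇ + n₁ * (n₂ * n₃ + n₂ * n₄ + n₃ * n₄ + n₂ + n₃)
  sum-selection s₁ s₇ = rearrange (weight s₁) (weight s₇)
    where
    rearrange : ∀ w₁ w₇ →
      w₁ + (n₁ * (n₃ * (n₄ * 1)) + (n₁ * (n₂ * (n₄ * 1)) + (n₁ * (n₂ * (n₃ * 1)) +
        (n₁ * (n₂ * 1) + (n₁ * (n₃ * 1) + (w₇ + 0)))))) ≡
      w₁ + w₇ + n₁ * (n₂ * n₃ + n₂ * n₄ + n₃ * n₄ + n₂ + n₃)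
    rearrange w₁ w₇ = solve (w₁ List.∷ w₇ List.∷ n₁ List.∷ n₂ List.∷ n₃ List.∷ n₄ List.∷ List.[])

  sum-I : sum (map weight selection-I) ≡ n₁ * (n₂ * n₃ + n₂ * n₄ + n₃ * n₄ + n₂ + n₃ + n₄ + 1)
  sum-I = begin
    sum (map weight selection-I)                                     ≡⟨ sum-selection ⁅ # 0 ⁆ (⁅ # 0 ⁆ ∪ ⁅ # 3 ⁆) ⟩
    n₁ * 1 + n₁ * (n₄ * 1) + n₁ * (n₂ * n₃ + n₂ * n₄ + n₃ * n₄ + n₂ + n₃) ≡⟨ solve (n₁ List.∷ n₂ List.∷ n₃ List.∷ n₄ List.∷ List.[]) ⟩
    n₁ * (n₂ * n₃ + n₂ * n₄ + n₃ * n₄ + n₂ + n₃ + n₄ + 1)             ∎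
    where open ≡-Reasoning

  sum-II : sum (map weight selection-II) ≡ n₁ * (n₂ * n₃ + n₂ * n₄ + n₃ * n₄ + n₂ + n₃ + n₄) + n₂ * n₃ * n₄
  sum-II = begin
    sum (map weight selection-II)                                                  ≡⟨ sum-selection (∁ ⁅ # 0 ⁆) (⁅ # 0 ⁆ ∪ ⁅ # 3 ⁆) ⟩
    n₂ * (n₃ * (n₄ * 1)) + n₁ * (n₄ * 1) + n₁ * (n₂ * n₃ + n₂ * n₄ + n₃ * n₄ + n₂ + n₃) ≡⟨ solve (n₁ List.∷ n₂ List.∷ n₃ List.∷ n₄ List.∷ List.[]) ⟩
    n₁ * (n₂ * n₃ + n₂ * n₄ + n₃ * n₄ + n₂ + n₃ + n₄) + n₂ * n₃ * n₄               ∎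
    where open ≡-Reasoning

  sum-III : sum (map weight selection-III) ≡ n₁ * (n₂ * n₃ + n₂ * n₄ + n₃ * n₄ + n₂ + n₃) + n₂ * n₃ + n₂ * n₃ * n₄
  sum-III = begin
    sum (map weight selection-III)                                                 ≡⟨ sum-selection (∁ ⁅ # 0 ⁆) (⁅ # 1 ⁆ ∪ ⁅ # 2 ⁆) ⟩
    n₂ * (n₃ * (n₄ * 1)) + n₂ * (n₃ * 1) + n₁ * (n₂ * n₃ + n₂ * n₄ + n₃ * n₄ + n₂ + n₃) ≡⟨ solve (n₁ List.∷ n₂ List.∷ n₃ List.∷ n₄ List.∷ List.[]) ⟩
    n₁ * (n₂ * n₃ + n₂ * n₄ + n₃ * n₄ + n₂ + n₃) + n₂ * n₃ + n₂ * n₃ * n₄          ∎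
    where open ≡-Reasoning

theorem10 : ∀ {c ℓ : Level} (F₁ F₂ F₃ F₄ : CommutativeRing c ℓ) (n₁ n₂ n₃ n₄ : ℕ) →
    IsIntegralDomain F₁ → IsIntegralDomain F₂ → IsIntegralDomain F₃ → IsIntegralDomain F₄ →
    NonzeroCount F₁ n₁ → NonzeroCount F₂ n₂ → NonzeroCount F₃ n₃ → NonzeroCount F₄ n₄ →
    n₁ ≥ n₂ → n₂ ≥ n₃ → n₃ ≥ n₄ →
    (n₁ ≥ n₂ * n₃ * n₄ →
      IndependenceNumberIs (product4 F₁ F₂ F₃ F₄)
        (n₁ * (n₂ * n₃ + n₂ * n₄ + n₃ * n₄ + n₂ + n₃ + n₄ + 1)))
    × (n₁ ≤ n₂ * n₃ * n₄ → n₁ * n₄ ≥ n₂ * n₃ →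
      IndependenceNumberIs (product4 F₁ F₂ F₃ F₄)
        (n₁ * (n₂ * n₃ + n₂ * n₄ + n₃ * n₄ + n₂ + n₃ + n₄) + n₂ * n₃ * n₄))
    × (n₁ * n₄ ≤ n₂ * n₃ →
      IndependenceNumberIs (product4 F₁ F₂ F₃ F₄)
        (n₁ * (n₂ * n₃ + n₂ * n₄ + n₃ * n₄ + n₂ + n₃) + n₂ * n₃ + n₂ * n₃ * n₄))
theorem10 F₁ F₂ F₃ F₄ n₁ n₂ n₃ n₄ D₁ D₂ D₃ D₄ N₁ N₂ N₃ N₄ n₂≤n₁ n₃≤n₂ n₄≤n₃ =
    (λ h → α selection-I (from-yes (intersectingFamily? selection-I)) (heaviest-I h) sum-I)
  , (λ h h′ → α selection-II (from-yes (intersectingFamily? selection-II)) (heaviest-II h h′) sum-II)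
  , (λ h → α selection-III (from-yes (intersectingFamily? selection-III)) (heaviest-III h) sum-III)
  where
  open Product4 F₁ F₂ F₃ F₄ D₁ D₂ D₃ D₄ N₁ N₂ N₃ N₄ using (independenceNumber)
  open Selections n₂≤n₁ n₃≤n₂ n₄≤n₃ (Coordinates.1≤n F₄ D₄ N₄)
  open Weights n₁ n₂ n₃ n₄ using (weight; Heaviest)

  α : ∀ ss {k} → IntersectingFamily ss → Heaviest ss → sum (map weight ss) ≡ k →
      IndependenceNumberIs (product4 F₁ F₂ F₃ F₄) k
  α ss family heaviest refl = independenceNumber ss family heaviest
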